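{- Let $w\in\mathcal I_n$ with set of distinct entries $\mathrm{Alph}(w)=\{y_1<\dots<y_k\}$, and let $A=\Phi(w)$. Then $\mathrm{Min}(A)=\{y_1+1,\dots,y_k+1\}$ and $\dim(A)=|\mathrm{Alph}(w)|$.
   Context: $[a,b]=\{i\in\mathbb Z:a\le i\le b\}$. $\mathcal I_n$ is the set of sequences $(x_1,\dots,x_n)$ of integers with $0\le x_\ell\le\ell-1$ (inversion tables). For $w=(x_1,\dots,x_n)\in\mathcal I_n$ with $\mathrm{Alph}(w)=\{y_1<\dots<y_k\}$ (its set of distinct entries) and $y_{k+1}:=n$, $\Phi(w)$ is the $k\times k$ matrix whose $(i,j)$ entry is the set $\{\ell\in[1,n]: x_\ell=y_i\text{ and }y_j<\ell\le y_{j+1}\}$. For a square matrix $A$ whose entries are sets of integers, $\dim(A)$ is its number of rows, and $\mathrm{Min}(A)=\{\min(A_{\ast j}): 1\le j\le \dim(A)\}$ where $A_{\ast j}$ is the union of the entries in column $j$. -}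

module Defs where

open import Data.Nat using (ℕ; zero; suc; _+_; _≤_; _<_)
open import Data.Nat.Properties using (_≟_)
open import Data.Fin using (Fin; toℕ)
open import Data.Fin.Properties using (any?)
open import Data.List using (List; []; _∷_; length; filter; upTo; lookup; tabulate; deduplicate)
open import Data.Product using (Σ; ∃; _×_)

-- An inversion table of length n: w p is x_ℓ with ℓ = toℕ p + 1, and 0 ≤ x_ℓ ≤ ℓ - 1.
IsInvTable : (n : ℕ) → (Fin n → ℕ) → Set
IsInvTable n w = ∀ p → w p ≤ toℕ p

-- Alph(w) listed increasingly: y_1 < ... < y_k (entries are < n).
alph : (n : ℕ) → (Fin n → ℕ) → List ℕ
alph n w = filter (λ y → any? (λ p → w p ≟ y)) (upTo n)

alphCard : (n : ℕ) → (Fin n → ℕ) → ℕ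
alphCard n w = length (deduplicate _≟_ (tabulate w))

nth : List ℕ → ℕ → ℕ → ℕ
nth []       _       d = d
nth (x ∷ xs) zero    d = x
nth (x ∷ xs) (suc i) d = nth xs i d

record SetMatrix : Set₁ where
  field
    dim   : ℕ
    entry : Fin dim → Fin dim → ℕ → Set
open SetMatrix public

-- Φ(w): entry (i,j) = { ℓ ∈ [1,n] : x_ℓ = y_i and y_j < ℓ ≤ y_{j+1} }, with y_{k+1} = n.
Φ : (n : ℕ) → (Fin n → ℕ) → SetMatrix
Φ n w = record
  { dim   = length (alph n w)
  ; entry = λ i j ℓ → Σ (Fin n) λ p →
      (ℓ ≡ℕ suc (toℕ p)) × (w p ≡ℕ lookup (alph n w) i)
        × (lookup (alph n w) j < ℓ) × (ℓ ≤ nth (alph n w) (suc (toℕ j)) n)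
  }
  where
  open import Relation.Binary.PropositionalEquality using () renaming (_≡_ to _≡ℕ_)

column : (A : SetMatrix) → Fin (dim A) → ℕ → Set
column A j ℓ = ∃ λ i → entry A i j ℓ

IsMinOf : (ℕ → Set) → ℕ → Set
IsMinOf S m = S m × (∀ l → S l → m ≤ l)

Min : SetMatrix → ℕ → Set
Min A m = ∃ λ j → IsMinOf (column A j) m

module Submission where

-- Every ℓ in column j of A lies in the window
-- y_j < ℓ ≤ y_{j+1}, so min(A_{*j}) ≥ y_j + 1.  Conversely ℓ = y_j + 1 belongs to
-- the column: since y_j ≤ n - 1 there is a position ℓ = y_j + 1, its entry
-- x_ℓ ≤ ℓ - 1 < n is some y_i, and y_j < y_j + 1 ≤ y_{j+1} because the list of
-- distinct entries is strictly increasing and bounded by n = y_{k+1}.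
--
-- Dimension.  dim(A) is the length of alph n w, |Alph(w)| is the length of
-- deduplicate (tabulate w).  Both lists are duplicate-free with the same
-- members, so they are permutations of each other and have equal length.

open import Defs
open import Data.Nat using (ℕ; suc; _<_; _≤_; s≤s)
open import Data.Nat.Properties using (_≟_; ≤-antisym; <-≤-trans; <⇒≢; n<1+n)
open import Data.Fin as Fin using (Fin; toℕ; fromℕ<)
open import Data.Fin.Properties using (any?; toℕ-fromℕ<; toℕ<n)
open import Data.List using (List; []; _∷_; length; lookup; filter; upTo; tabulate; deduplicate)
open import Data.List.Membership.Propositional using (_∈_)
open import Data.List.Membership.Propositional.Properties
  using (∈-filter⁺; ∈-filter⁻; ∈-upTo⁺; ∈-upTo⁻; ∈-tabulate⁺; ∈-tabulate⁻; ∈-lookup; deduplicate-∈⇔)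
open import Data.List.Membership.Propositional.Properties.WithK using (unique∧set⇒bag)
open import Data.List.Relation.Binary.BagAndSetEquality using (∼bag⇒↭)
open import Data.List.Relation.Binary.Permutation.Propositional.Properties using (↭-length)
open import Data.List.Relation.Unary.Any using (index)
open import Data.List.Relation.Unary.Any.Properties using (lookup-index)
open import Data.List.Relation.Unary.All as All using (All; []; _∷_)
open import Data.List.Relation.Unary.AllPairs as AllPairs using (AllPairs; _∷_)
open import Data.List.Relation.Unary.AllPairs.Properties using (filter⁺; applyUpTo⁺₁)
open import Data.List.Relation.Unary.Unique.Propositional using (Unique)
open import Data.List.Relation.Unary.Unique.DecPropositional.Properties _≟_ using (deduplicate-!)
open import Data.Product using (∃; _×_; _,_; proj₁)
open import Function.Bundles using (_⇔_; mk⇔; Equivalence)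
open import Relation.Nullary using (Dec)
open import Relation.Binary.PropositionalEquality using (_≡_; refl; sym; cong)

unique-sameMembers⇒length≡ : {A : Set} {xs ys : List A} → Unique xs → Unique ys →
  (∀ {z} → z ∈ xs ⇔ z ∈ ys) → length xs ≡ length ys
unique-sameMembers⇒length≡ xs! ys! same = ↭-length (∼bag⇒↭ (unique∧set⇒bag xs! ys! same))

-- In a strictly increasing list bounded by b, every entry is smaller than the
-- next one, where the entry after the last is taken to be b (this is y_{k+1} := n).
lookup<next : (b : ℕ) (xs : List ℕ) → AllPairs _<_ xs → All (_< b) xs →
  (j : Fin (length xs)) → lookup xs j < nth xs (suc (toℕ j)) b
lookup<next b (x ∷ [])     _                 (x<b ∷ []) Fin.zero    = x<b
lookup<next b (x ∷ y ∷ xs) ((x<y ∷ _) ∷ _)   _          Fin.zero    = x<y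
lookup<next b (x ∷ y ∷ xs) (_ ∷ increasing)  (_ ∷ bnd)  (Fin.suc j) =
  lookup<next b (y ∷ xs) increasing bnd j

IsMinOf-unique : {S : ℕ → Set} {m m′ : ℕ} → IsMinOf S m → IsMinOf S m′ → m ≡ m′
IsMinOf-unique (m∈S , m≤) (m′∈S , m′≤) = ≤-antisym (m≤ _ m′∈S) (m′≤ _ m∈S)

module _ (n : ℕ) (w : Fin n → ℕ) where

  private
    occurs? : (y : ℕ) → Dec (∃ λ p → w p ≡ y)
    occurs? y = any? (λ p → w p ≟ y)

  ∈-alph⁻ : ∀ {y} → y ∈ alph n w → (y < n) × ∃ λ p → w p ≡ y
  ∈-alph⁻ y∈ with y∈upTo , occurs ← ∈-filter⁻ occurs? {xs = upTo n} y∈ = ∈-upTo⁻ y∈upTo , occurs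

  ∈-alph⁺ : ∀ p → w p < n → w p ∈ alph n w
  ∈-alph⁺ p wp<n = ∈-filter⁺ occurs? (∈-upTo⁺ wp<n) (p , refl)

  -- alph n w lists y₁ < … < y_k: a sublist of the increasing list 0, …, n - 1.
  alph-increasing : AllPairs _<_ (alph n w)
  alph-increasing = filter⁺ occurs? (applyUpTo⁺₁ (λ i → i) n (λ i<j _ → i<j))

  alph-unique : Unique (alph n w)
  alph-unique = AllPairs.map <⇒≢ alph-increasing

  alph-bounded : All (_< n) (alph n w)
  alph-bounded = All.tabulate (λ y∈ → proj₁ (∈-alph⁻ y∈))

  column-lowerBound : ∀ j {ℓ} → column (Φ n w) j ℓ → suc (lookup (alph n w) j) ≤ ℓ
  column-lowerBound j (_ , _ , _ , _ , yⱼ<ℓ , _) = yⱼ<ℓ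

module _ (n : ℕ) (w : Fin n → ℕ) (inv : IsInvTable n w) where

  -- In an inversion table every entry x_ℓ ≤ ℓ - 1 < n is a member of Alph(w).
  entry∈alph : ∀ p → w p ∈ alph n w
  entry∈alph p = ∈-alph⁺ n w p (<-≤-trans (s≤s (inv p)) (toℕ<n p))

  -- y_j + 1 lies in column j: take position ℓ = y_j + 1 (it exists since y_j < n)
  -- and the row i with y_i = x_ℓ; the window condition y_j < ℓ ≤ y_{j+1} is lookup<next.
  column-contains : ∀ j → column (Φ n w) j (suc (lookup (alph n w) j))
  column-contains j =
    index (entry∈alph p) , p , cong suc (sym (toℕ-fromℕ< yⱼ<n)) , lookup-index (entry∈alph p) ,
    n<1+n _ , lookup<next n (alph n w) (alph-increasing n w) (alph-bounded n w) j
    where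
    yⱼ<n : lookup (alph n w) j < n
    yⱼ<n = proj₁ (∈-alph⁻ n w (∈-lookup j))
    p : Fin n
    p = fromℕ< yⱼ<n

  column-min : ∀ j → IsMinOf (column (Φ n w) j) (suc (lookup (alph n w) j))
  column-min j = column-contains j , λ ℓ ℓ∈ → column-lowerBound n w j ℓ∈

  alph⇔entries : ∀ {y} → y ∈ alph n w ⇔ y ∈ deduplicate _≟_ (tabulate w)
  alph⇔entries = mk⇔ to from
    where
    to : ∀ {y} → y ∈ alph n w → y ∈ deduplicate _≟_ (tabulate w)
    to y∈ with _ , p , refl ← ∈-alph⁻ n w y∈ = Equivalence.to (deduplicate-∈⇔ _≟_) (∈-tabulate⁺ p)
    from : ∀ {y} → y ∈ deduplicate _≟_ (tabulate w) → y ∈ alph n w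
    from y∈ with p , refl ← ∈-tabulate⁻ (Equivalence.from (deduplicate-∈⇔ _≟_) y∈) = entry∈alph p

proposition4 : (n : ℕ) (w : Fin n → ℕ) → IsInvTable n w →
    (∀ m → Min (Φ n w) m ⇔ (∃ λ (i : Fin (length (alph n w))) → m ≡ suc (lookup (alph n w) i)))
    × (dim (Φ n w) ≡ alphCard n w)
proposition4 n w inv = minima , dimension
  where
  minima : ∀ m → Min (Φ n w) m ⇔ (∃ λ (i : Fin (length (alph n w))) → m ≡ suc (lookup (alph n w) i))
  minima m = mk⇔ (λ { (j , m-min) → j , IsMinOf-unique m-min (column-min n w inv j) })
                 (λ { (j , refl) → j , column-min n w inv j })
  dimension : length (alph n w) ≡ length (deduplicate _≟_ (tabulate w))
  dimension = unique-sameMembers⇒length≡ (alph-unique n w) (deduplicate-! (tabulate w)) (alph⇔entries n w inv)
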